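{- Let $G$ be a finite simple graph, $A_1,A_2$ disjoint subsets of $V(G)$, and $G^*$ the graph obtained by toggling all pairs between $A_1$ and $A_2$, with closed neighborhood matrices $N$ and $N^*$. Suppose $A_1$ and $A_2$ are AO sets in $G$ and $A_2$ is $\overline{\mathbf{x}_{A_1}}$-NO in $G$. Then for every pattern $\mathbf{p}$, $N^*\mathbf{p}=\mathbf{1}$ if and only if $N\mathbf{p}=\overline{\mathbf{x}_{A_1\cup A_2}}$. Moreover, $A_1$ and $A_2$ are AO in $G^*$ and $\nu(G^*)=\nu(G)$.
   Context: For a graph $H$ with vertex set $V=\{v_1,\dots,v_n\}$, $N(H)$ is the closed neighborhood matrix over $\mathbb{Z}_2$ (entry $(i,j)$ is $1$ iff $i=j$ or $v_iv_j$ is an edge), $\nu(H)=\dim\ker N(H)$. Given disjoint $A_1,A_2\subseteq V(G)$, $G^*$ is obtained from $G$ by, for every $u\in A_1$, $v\in A_2$, adding the edge $uv$ if $u,v$ are non-adjacent and removing it if they are adjacent; $N=N(G)$, $N^*=N(G^*)$. Subsets $A$ are identified with characteristic vectors $\mathbf{x}_A$; $\mathbf{x}\cdot\mathbf{y}=\mathbf{x}^t\mathbf{y}$ over $\mathbb{Z}_2$; $\mathbf{1}$ is the all-ones vector, $\overline{\mathbf{x}}:=\mathbf{x}+\mathbf{1}$. In a graph $H$ with matrix $M$: a pattern $\mathbf{p}$ solves configuration $\mathbf{c}$ if $M\mathbf{p}=\mathbf{c}$; $\mathbf{c}$ (or a set $A$ via $\mathbf{x}_A$) is solvable if some pattern solves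 it; $\mathbf{1}$ is always solvable. A set $A$ is HO if it is not solvable. For solvable $A$ and solvable $\mathbf{c}$, $A$ is $\mathbf{c}$-AO if $\mathbf{x}_A\cdot\mathbf{p}=1$ for all solving patterns $\mathbf{p}$ of $\mathbf{c}$, and $\mathbf{c}$-NO if $\mathbf{x}_A\cdot\mathbf{p}=0$ for all of them; AO and NO mean $\mathbf{1}$-AO and $\mathbf{1}$-NO. -}

module Defs where

open import Data.Nat using (ℕ; zero; suc)
open import Data.Fin using (Fin; zero; suc; _≟_)
open import Data.Bool using (Bool; true; false; _∧_; _∨_; _xor_; not)
open import Relation.Nullary.Decidable using (⌊_⌋)
open import Relation.Binary.PropositionalEquality using (_≡_; refl; cong₂)
import Data.Bool.Properties
open import Data.Product using (Σ; _×_; ∃)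
open import Function.Bundles using (_⇔_)

-- Vectors over Z₂ = Bool (false = 0, true = 1, xor = +, ∧ = ·),
-- represented as functions Fin n → Bool.  Subsets of V = Fin n are
-- identified with their characteristic vectors.
Vec₂ : ℕ → Set
Vec₂ n = Fin n → Bool

Σ₂ : ∀ {n} → (Fin n → Bool) → Bool
Σ₂ {zero}  f = false
Σ₂ {suc n} f = f zero xor Σ₂ (λ i → f (suc i))

_≐_ : ∀ {n} → Vec₂ n → Vec₂ n → Set
x ≐ y = ∀ i → x i ≡ y i

_·_ : ∀ {n} → Vec₂ n → Vec₂ n → Bool
x · y = Σ₂ (λ i → x i ∧ y i)

𝟏 : ∀ {n} → Vec₂ n
𝟏 _ = true

𝟎 : ∀ {n} → Vec₂ n
𝟎 _ = false

‾_ : ∀ {n} → Vec₂ n → Vec₂ n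
(‾ x) i = not (x i)

_∪_ : ∀ {n} → Vec₂ n → Vec₂ n → Vec₂ n
(A ∪ B) i = A i ∨ B i

Mat₂ : ℕ → Set
Mat₂ n = Fin n → Fin n → Bool

_⊛_ : ∀ {n} → Mat₂ n → Vec₂ n → Vec₂ n
(M ⊛ p) i = Σ₂ (λ j → M i j ∧ p j)

record Graph (n : ℕ) : Set where
  field
    adj   : Fin n → Fin n → Bool
    sym   : ∀ i j → adj i j ≡ adj j i
    irrefl : ∀ i → adj i i ≡ false
open Graph public

N : ∀ {n} → Graph n → Mat₂ n
N H i j = ⌊ i ≟ j ⌋ ∨ adj H i j

Disjoint : ∀ {n} → Vec₂ n → Vec₂ n → Set
Disjoint A B = ∀ i → A i ∧ B i ≡ false

toggleAdj : ∀ {n} → Graph n → Vec₂ n → Vec₂ n → Fin n → Fin n → Bool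
toggleAdj G A₁ A₂ i j = adj G i j xor ((A₁ i ∧ A₂ j) ∨ (A₂ i ∧ A₁ j))

-- the toggled graph (needs disjointness for looplessness)
private
  swapLem : ∀ a b c d → (a ∧ b) ∨ (c ∧ d) ≡ (d ∧ c) ∨ (b ∧ a)
  swapLem false false false false = refl
  swapLem false false false true = refl
  swapLem false false true false = refl
  swapLem false false true true = refl
  swapLem false true false false = refl
  swapLem false true false true = refl
  swapLem false true true false = refl
  swapLem false true true true = refl
  swapLem true false false false = refl
  swapLem true false false true = refl
  swapLem true false true false = refl
  swapLem true false true true = refl
  swapLem true true false false = refl
  swapLem true true false true = refl
  swapLem true true true false = refl
  swapLem true true true true = refl

  diagLem : ∀ a b → a ∧ b ≡ false → (a ∧ b) ∨ (b ∧ a) ≡ false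
  diagLem false false e = refl
  diagLem false true e = refl
  diagLem true false e = refl
  diagLem true true ()

toggle : ∀ {n} (G : Graph n) (A₁ A₂ : Vec₂ n) → Disjoint A₁ A₂ → Graph n
toggle {n} G A₁ A₂ d = record
  { adj = toggleAdj G A₁ A₂ ; sym = symT ; irrefl = irr }
  where
  symT : ∀ i j → toggleAdj G A₁ A₂ i j ≡ toggleAdj G A₁ A₂ j i
  symT i j = cong₂ _xor_ (sym G i j) (swapLem (A₁ i) (A₂ j) (A₂ i) (A₁ j))
  irr : ∀ i → toggleAdj G A₁ A₂ i i ≡ false
  irr i = cong₂ _xor_ (irrefl G i) (diagLem (A₁ i) (A₂ i) (d i))

Solves : ∀ {n} → Mat₂ n → Vec₂ n → Vec₂ n → Set
Solves M p c = (M ⊛ p) ≐ c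

Solvable : ∀ {n} → Mat₂ n → Vec₂ n → Set
Solvable M c = ∃ λ p → Solves M p c

_-AO[_]_ : ∀ {n} → Vec₂ n → Mat₂ n → Vec₂ n → Set
c -AO[ M ] A = Solvable M A × Solvable M c × (∀ p → Solves M p c → A · p ≡ true)

_-NO[_]_ : ∀ {n} → Vec₂ n → Mat₂ n → Vec₂ n → Set
c -NO[ M ] A = Solvable M A × Solvable M c × (∀ p → Solves M p c → A · p ≡ false)

AO : ∀ {n} → Mat₂ n → Vec₂ n → Set
AO M A = 𝟏 -AO[ M ] A

lincomb : ∀ {n k} → (Fin k → Vec₂ n) → Vec₂ k → Vec₂ n
lincomb b c j = Σ₂ (λ i → c i ∧ b i j)

IsKernelBasis : ∀ {n k} → Mat₂ n → (Fin k → Vec₂ n) → Set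
IsKernelBasis M b =
    (∀ i → (M ⊛ b i) ≐ 𝟎)
  × (∀ c → lincomb b c ≐ 𝟎 → c ≐ 𝟎)
  × (∀ x → (M ⊛ x) ≐ 𝟎 → ∃ λ c → lincomb b c ≐ x)

-- ν(H) = k, i.e. dim ker N(H) = k : ker N(H) has a basis of size k
HasNullity : ∀ {n} → Graph n → ℕ → Set
HasNullity H k = ∃ λ (b : Fin k → Vec₂ _) → IsKernelBasis (N H) b

-- Over Z₂ a closed neighbourhood matrix is symmetric with unit diagonal, so
-- N q = A and N p = c give A · p = q · c, and q · N q = q · 𝟏.  Take N q₁ = A₁ and
-- N q₂ = A₂; the hypotheses amount to q₁ and q₂ having dot product 1 with each of
-- 𝟏, A₁, A₂.  Since N* p = N p + (A₂ · p) A₁ + (A₁ · p) A₂, this gives N* q₁ = A₂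
-- and N* q₂ = A₁, so A₁ · p and A₂ · p can be read off from N p (as q₁ · N p and
-- q₂ · N p) and equally from N* p (as q₂ · N* p and q₁ · N* p).  For a solution of
-- N* p = 𝟏 or of N p = 𝟏 + A₁ + A₂ both are 1, hence N* p = N p + A₁ + A₂; for a
-- kernel vector of either matrix both are 0, hence N* p = N p.
module Submission where

open import Defs hiding (sym)
open import Data.Nat using (zero; suc)
open import Data.Fin using (Fin; zero; suc; _≟_)
open import Data.Bool using (Bool; true; false; _∧_; _∨_; _xor_; not)
open import Data.Bool.Properties
  using ( ∧-comm; ∧-assoc; ∧-identityʳ; ∧-zeroʳ; ∧-distribˡ-xor; ∧-distribʳ-xor
        ; ∧-commutativeMonoid; xor-assoc; xor-same; xor-identityʳ; not-involutive
        ; ∨-identityʳ; xor-∧-commutativeRing )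
open import Data.Product using (_×_; _,_)
open import Function.Bundles using (_⇔_; mk⇔; Equivalence)
open import Function.Properties.Equivalence using () renaming (sym to ⇔-sym)
open import Relation.Nullary using (yes; no)
open import Relation.Nullary.Decidable using (⌊_⌋; does; isYes≗does; does-⇔; dec-true)
open import Relation.Binary.PropositionalEquality
  using (_≡_; refl; sym; trans; cong; cong₂; module ≡-Reasoning)
open import Algebra.Bundles using (CommutativeMonoid; CommutativeRing)
open import Algebra.Properties.CommutativeSemigroup
  (CommutativeMonoid.commutativeSemigroup ∧-commutativeMonoid) using (x∙yz≈z∙yx)
open import Algebra.Properties.Semiring.Sum (CommutativeRing.semiring xor-∧-commutativeRing)
  using (sum; sum-cong-≗; ∑-distrib-+; ∑-comm; *-distribˡ-sum; sum-replicate-zero)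

open ≡-Reasoning

xor-cancel-middle : ∀ a r t → (a xor r) xor (r xor t) ≡ a xor t
xor-cancel-middle a r t = begin
  (a xor r) xor (r xor t)  ≡⟨ xor-assoc a r (r xor t) ⟩
  a xor (r xor (r xor t))  ≡⟨ cong (a xor_) (sym (xor-assoc r r t)) ⟩
  a xor ((r xor r) xor t)  ≡⟨ cong (λ z → a xor (z xor t)) (xor-same r) ⟩
  a xor t                  ∎

xor-cancel-outer : ∀ a b → (b xor a) xor b ≡ a
xor-cancel-outer false false = refl
xor-cancel-outer true  false = refl
xor-cancel-outer false true  = refl
xor-cancel-outer true  true  = refl

xor-xor-move : ∀ {x y} a b → (x xor a) xor b ≡ y → x ≡ (y xor a) xor b
xor-xor-move {false} false false refl = refl
xor-xor-move {false} false true  refl = refl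
xor-xor-move {false} true  false refl = refl
xor-xor-move {false} true  true  refl = refl
xor-xor-move {true}  false false refl = refl
xor-xor-move {true}  false true  refl = refl
xor-xor-move {true}  true  false refl = refl
xor-xor-move {true}  true  true  refl = refl

not-∨-disjoint : ∀ a b → a ∧ b ≡ false → not (a ∨ b) ≡ (true xor a) xor b
not-∨-disjoint false false _ = refl
not-∨-disjoint false true  _ = refl
not-∨-disjoint true  false _ = refl

Σ₂≡sum : ∀ {n} → Σ₂ {n} ≡ sum
Σ₂≡sum {zero}  = refl
Σ₂≡sum {suc n} = cong (λ S f → f zero xor S (λ i → f (suc i))) Σ₂≡sum

Σ₂-cong : ∀ {n} {f g : Vec₂ n} → f ≐ g → Σ₂ f ≡ Σ₂ g
Σ₂-cong {n} f≐g rewrite Σ₂≡sum {n} = sum-cong-≗ f≐g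

Σ₂-xor : ∀ {n} (f g : Vec₂ n) → Σ₂ (λ i → f i xor g i) ≡ Σ₂ f xor Σ₂ g
Σ₂-xor {n} f g rewrite Σ₂≡sum {n} = ∑-distrib-+ f g

Σ₂-∧ˡ : ∀ {n} a (f : Vec₂ n) → Σ₂ (λ i → a ∧ f i) ≡ a ∧ Σ₂ f
Σ₂-∧ˡ {n} a f rewrite Σ₂≡sum {n} = sym (*-distribˡ-sum a f)

Σ₂-zero : ∀ {n} → Σ₂ {n} 𝟎 ≡ false
Σ₂-zero {n} rewrite Σ₂≡sum {n} = sum-replicate-zero n

Σ₂-comm : ∀ {m n} (f : Fin m → Fin n → Bool) →
          Σ₂ (λ i → Σ₂ (λ j → f i j)) ≡ Σ₂ (λ j → Σ₂ (λ i → f i j))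
Σ₂-comm {m} {n} f rewrite Σ₂≡sum {m} | Σ₂≡sum {n} = ∑-comm f

-- The off-diagonal terms f i j and f j i cancel in pairs.
Σ₂-symmetric : ∀ {n} (f : Fin n → Fin n → Bool) → (∀ i j → f i j ≡ f j i) →
               Σ₂ (λ i → Σ₂ (λ j → f i j)) ≡ Σ₂ (λ i → f i i)
Σ₂-symmetric {zero}  f f-sym = refl
Σ₂-symmetric {suc n} f f-sym = begin
  (f₀₀ xor row) xor Σ₂ (λ i → f (suc i) zero xor Σ₂ (λ j → f (suc i) (suc j)))
    ≡⟨ cong ((f₀₀ xor row) xor_) (Σ₂-xor (λ i → f (suc i) zero) _) ⟩
  (f₀₀ xor row) xor (Σ₂ (λ i → f (suc i) zero) xor Σ₂ (λ i → Σ₂ (λ j → f (suc i) (suc j))))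
    ≡⟨ cong₂ (λ c t → (f₀₀ xor row) xor (c xor t))
             (Σ₂-cong (λ i → f-sym (suc i) zero))
             (Σ₂-symmetric (λ i j → f (suc i) (suc j)) (λ i j → f-sym (suc i) (suc j))) ⟩
  (f₀₀ xor row) xor (row xor Σ₂ (λ i → f (suc i) (suc i)))
    ≡⟨ xor-cancel-middle f₀₀ row _ ⟩
  f₀₀ xor Σ₂ (λ i → f (suc i) (suc i)) ∎
  where
  f₀₀ = f zero zero
  row = Σ₂ (λ j → f zero (suc j))

infixl 6 _⊕_

_⊕_ : ∀ {n} → Vec₂ n → Vec₂ n → Vec₂ n
(x ⊕ y) i = x i xor y i

·-comm : ∀ {n} (x y : Vec₂ n) → x · y ≡ y · x
·-comm x y = Σ₂-cong (λ i → ∧-comm (x i) (y i))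

·-congˡ : ∀ {n} (x : Vec₂ n) {y z : Vec₂ n} → y ≐ z → x · y ≡ x · z
·-congˡ x y≐z = Σ₂-cong (λ i → cong (x i ∧_) (y≐z i))

·-congʳ : ∀ {n} {x y : Vec₂ n} (z : Vec₂ n) → x ≐ y → x · z ≡ y · z
·-congʳ z x≐y = Σ₂-cong (λ i → cong (_∧ z i) (x≐y i))

·-distribˡ-⊕ : ∀ {n} (x y z : Vec₂ n) → x · (y ⊕ z) ≡ x · y xor x · z
·-distribˡ-⊕ x y z =
  trans (Σ₂-cong (λ i → ∧-distribˡ-xor (x i) (y i) (z i)))
        (Σ₂-xor (λ i → x i ∧ y i) (λ i → x i ∧ z i))

·-zeroʳ : ∀ {n} (x : Vec₂ n) → x · 𝟎 ≡ false
·-zeroʳ {n} x = trans (Σ₂-cong (λ i → ∧-zeroʳ (x i))) (Σ₂-zero {n})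

Symmetric : ∀ {n} → Mat₂ n → Set
Symmetric M = ∀ i j → M i j ≡ M j i

diag : ∀ {n} → Mat₂ n → Vec₂ n
diag M i = M i i

⊛-distrib-⊕ : ∀ {n} (M : Mat₂ n) (x y : Vec₂ n) → (M ⊛ (x ⊕ y)) ≐ ((M ⊛ x) ⊕ (M ⊛ y))
⊛-distrib-⊕ M x y i = ·-distribˡ-⊕ (M i) x y

module _ {n} {M : Mat₂ n} (M-sym : Symmetric M) where

  ⊛-adjoint : ∀ x y → x · (M ⊛ y) ≡ (M ⊛ x) · y
  ⊛-adjoint x y = begin
    Σ₂ (λ i → x i ∧ Σ₂ (λ j → M i j ∧ y j))       ≡⟨ Σ₂-cong (λ i → sym (Σ₂-∧ˡ (x i) (λ j → M i j ∧ y j))) ⟩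
    Σ₂ (λ i → Σ₂ (λ j → x i ∧ (M i j ∧ y j)))     ≡⟨ Σ₂-comm (λ i j → x i ∧ (M i j ∧ y j)) ⟩
    Σ₂ (λ j → Σ₂ (λ i → x i ∧ (M i j ∧ y j)))     ≡⟨ Σ₂-cong (λ j → Σ₂-cong (λ i → swap i j)) ⟩
    Σ₂ (λ j → Σ₂ (λ i → y j ∧ (M j i ∧ x i)))     ≡⟨ Σ₂-cong (λ j → Σ₂-∧ˡ (y j) (λ i → M j i ∧ x i)) ⟩
    y · (M ⊛ x)                                   ≡⟨ ·-comm y (M ⊛ x) ⟩
    (M ⊛ x) · y                                   ∎
    where
    swap : ∀ i j → x i ∧ (M i j ∧ y j) ≡ y j ∧ (M j i ∧ x i)
    swap i j = trans (x∙yz≈z∙yx (x i) (M i j) (y j)) (cong (λ m → y j ∧ (m ∧ x i)) (M-sym i j))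

  ·-⊛-self : ∀ x → x · (M ⊛ x) ≡ diag M · x
  ·-⊛-self x = begin
    Σ₂ (λ i → x i ∧ Σ₂ (λ j → M i j ∧ x j))       ≡⟨ Σ₂-cong (λ i → sym (Σ₂-∧ˡ (x i) (λ j → M i j ∧ x j))) ⟩
    Σ₂ (λ i → Σ₂ (λ j → x i ∧ (M i j ∧ x j)))     ≡⟨ Σ₂-symmetric (λ i j → x i ∧ (M i j ∧ x j)) swap ⟩
    Σ₂ (λ i → x i ∧ (M i i ∧ x i))                ≡⟨ Σ₂-cong (λ i → absorb (x i) (M i i)) ⟩
    diag M · x                                    ∎
    where
    swap : ∀ i j → x i ∧ (M i j ∧ x j) ≡ x j ∧ (M j i ∧ x i)
    swap i j = trans (x∙yz≈z∙yx (x i) (M i j) (x j)) (cong (λ m → x j ∧ (m ∧ x i)) (M-sym i j))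
    absorb : ∀ a m → a ∧ (m ∧ a) ≡ m ∧ a
    absorb false m = sym (∧-zeroʳ m)
    absorb true  m = refl

  solution-duality : ∀ {q a p c} → Solves M q a → Solves M p c → a · p ≡ q · c
  solution-duality {q} {a} {p} {c} hq hp = begin
    a · p        ≡⟨ ·-congʳ p (λ i → sym (hq i)) ⟩
    (M ⊛ q) · p  ≡⟨ sym (⊛-adjoint q p) ⟩
    q · (M ⊛ p)  ≡⟨ ·-congˡ q hp ⟩
    q · c        ∎

  AO⇒·≡true : ∀ {c A q} → c -AO[ M ] A → Solves M q A → q · c ≡ true
  AO⇒·≡true (_ , (p , hp) , AO-p) hq = trans (sym (solution-duality hq hp)) (AO-p p hp)

  NO⇒·≡false : ∀ {c A q} → c -NO[ M ] A → Solves M q A → q · c ≡ false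
  NO⇒·≡false (_ , (p , hp) , NO-p) hq = trans (sym (solution-duality hq hp)) (NO-p p hp)

  ·≡true⇒AO : ∀ {c A q} → Solves M q A → Solvable M c → q · c ≡ true → c -AO[ M ] A
  ·≡true⇒AO {q = q} hq c-solvable q·c = (q , hq) , c-solvable ,
    λ p hp → trans (solution-duality hq hp) q·c

SameKernel : ∀ {n} → Mat₂ n → Mat₂ n → Set
SameKernel M M′ = ∀ x → (M ⊛ x) ≐ 𝟎 ⇔ (M′ ⊛ x) ≐ 𝟎

SameKernel⇒IsKernelBasis : ∀ {n k} {M M′ : Mat₂ n} {b : Fin k → Vec₂ n} →
                           SameKernel M M′ → IsKernelBasis M b → IsKernelBasis M′ b
SameKernel⇒IsKernelBasis same (b-in-ker , b-independent , b-spans) =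
  (λ i → Equivalence.to (same _) (b-in-ker i)) , b-independent ,
  (λ x hx → b-spans x (Equivalence.from (same x) hx))

SameKernel⇒HasNullity⇔ : ∀ {n} {H H′ : Graph n} → SameKernel (N H) (N H′) →
                         ∀ k → HasNullity H k ⇔ HasNullity H′ k
SameKernel⇒HasNullity⇔ same k = mk⇔
  (λ (b , basis) → b , SameKernel⇒IsKernelBasis same basis)
  (λ (b , basis) → b , SameKernel⇒IsKernelBasis (λ x → ⇔-sym (same x)) basis)

crossUpdate : ∀ {n} → Mat₂ n → Vec₂ n → Vec₂ n → Mat₂ n
crossUpdate M u v i j = (M i j xor (u i ∧ v j)) xor (v i ∧ u j)

⊛-crossUpdate : ∀ {n} (M : Mat₂ n) (u v p : Vec₂ n) i →
                (crossUpdate M u v ⊛ p) i ≡ ((M ⊛ p) i xor (u i ∧ v · p)) xor (v i ∧ u · p)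
⊛-crossUpdate M u v p i = begin
  Σ₂ (λ j → crossUpdate M u v i j ∧ p j)
    ≡⟨ Σ₂-cong (λ j → distrib (M i j) (u i) (v j) (v i) (u j) (p j)) ⟩
  Σ₂ (λ j → ((M i j ∧ p j) xor (u i ∧ (v j ∧ p j))) xor (v i ∧ (u j ∧ p j)))
    ≡⟨ Σ₂-xor (λ j → (M i j ∧ p j) xor (u i ∧ (v j ∧ p j))) (λ j → v i ∧ (u j ∧ p j)) ⟩
  Σ₂ (λ j → (M i j ∧ p j) xor (u i ∧ (v j ∧ p j))) xor Σ₂ (λ j → v i ∧ (u j ∧ p j))
    ≡⟨ cong₂ _xor_ (Σ₂-xor (λ j → M i j ∧ p j) (λ j → u i ∧ (v j ∧ p j)))
                   (Σ₂-∧ˡ (v i) (λ j → u j ∧ p j)) ⟩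
  ((M ⊛ p) i xor Σ₂ (λ j → u i ∧ (v j ∧ p j))) xor (v i ∧ u · p)
    ≡⟨ cong (λ s → ((M ⊛ p) i xor s) xor (v i ∧ u · p)) (Σ₂-∧ˡ (u i) (λ j → v j ∧ p j)) ⟩
  ((M ⊛ p) i xor (u i ∧ v · p)) xor (v i ∧ u · p) ∎
  where
  distrib : ∀ m a b c e x →
            ((m xor (a ∧ b)) xor (c ∧ e)) ∧ x ≡ ((m ∧ x) xor (a ∧ (b ∧ x))) xor (c ∧ (e ∧ x))
  distrib m a b c e x = begin
    ((m xor (a ∧ b)) xor (c ∧ e)) ∧ x             ≡⟨ ∧-distribʳ-xor x (m xor (a ∧ b)) (c ∧ e) ⟩
    ((m xor (a ∧ b)) ∧ x) xor ((c ∧ e) ∧ x)       ≡⟨ cong₂ _xor_ (∧-distribʳ-xor x m (a ∧ b)) (∧-assoc c e x) ⟩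
    ((m ∧ x) xor ((a ∧ b) ∧ x)) xor (c ∧ (e ∧ x)) ≡⟨ cong (λ t → ((m ∧ x) xor t) xor _) (∧-assoc a b x) ⟩
    ((m ∧ x) xor (a ∧ (b ∧ x))) xor (c ∧ (e ∧ x)) ∎

⌊≟⌋-sym : ∀ {n} (i j : Fin n) → ⌊ i ≟ j ⌋ ≡ ⌊ j ≟ i ⌋
⌊≟⌋-sym i j = begin
  ⌊ i ≟ j ⌋    ≡⟨ isYes≗does (i ≟ j) ⟩
  does (i ≟ j) ≡⟨ does-⇔ (mk⇔ sym sym) (i ≟ j) (j ≟ i) ⟩
  does (j ≟ i) ≡⟨ isYes≗does (j ≟ i) ⟨
  ⌊ j ≟ i ⌋    ∎

N-symmetric : ∀ {n} (H : Graph n) → Symmetric (N H)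
N-symmetric H i j = cong₂ _∨_ (⌊≟⌋-sym i j) (Graph.sym H i j)

N-diag : ∀ {n} (H : Graph n) → diag (N H) ≐ 𝟏
N-diag H i = cong (_∨ adj H i i) (trans (isYes≗does (i ≟ i)) (dec-true (i ≟ i) refl))

·-N⊛-self : ∀ {n} (H : Graph n) (x : Vec₂ n) → x · (N H ⊛ x) ≡ x · 𝟏
·-N⊛-self H x = begin
  x · (N H ⊛ x)  ≡⟨ ·-⊛-self (N-symmetric H) x ⟩
  diag (N H) · x ≡⟨ ·-congʳ x (N-diag H) ⟩
  𝟏 · x          ≡⟨ ·-comm 𝟏 x ⟩
  x · 𝟏          ∎

module Toggled {n} (G : Graph n) (A₁ A₂ : Vec₂ n) (d : Disjoint A₁ A₂) where

  G* : Graph n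
  G* = toggle G A₁ A₂ d

  N-toggle : ∀ i j → N G* i j ≡ crossUpdate (N G) A₁ A₂ i j
  N-toggle i j with i ≟ j
  ... | yes refl = on-diagonal (A₁ i) (A₂ i) (d i)
    where
    on-diagonal : ∀ a b → a ∧ b ≡ false → true ≡ (true xor (a ∧ b)) xor (b ∧ a)
    on-diagonal false false _ = refl
    on-diagonal false true  _ = refl
    on-diagonal true  false _ = refl
  ... | no _ = off-diagonal (adj G i j) (A₁ i) (A₂ i) (A₁ j) (A₂ j) (d i)
    where
    off-diagonal : ∀ g a₁ a₂ a₁′ a₂′ → a₁ ∧ a₂ ≡ false →
                   g xor ((a₁ ∧ a₂′) ∨ (a₂ ∧ a₁′)) ≡ (g xor (a₁ ∧ a₂′)) xor (a₂ ∧ a₁′)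
    off-diagonal g false _     _ _   _ = cong (_xor _) (sym (xor-identityʳ g))
    off-diagonal g true  false _ a₂′ _ =
      trans (cong (g xor_) (∨-identityʳ a₂′)) (sym (xor-identityʳ (g xor a₂′)))

  toggle-⊛ : ∀ p i → (N G* ⊛ p) i ≡ ((N G ⊛ p) i xor (A₁ i ∧ A₂ · p)) xor (A₂ i ∧ A₁ · p)
  toggle-⊛ p i = trans (Σ₂-cong (λ j → cong (_∧ p j) (N-toggle i j))) (⊛-crossUpdate (N G) A₁ A₂ p i)

  toggle-⊛-true : ∀ {p} → A₁ · p ≡ true → A₂ · p ≡ true → (N G* ⊛ p) ≐ (N G ⊛ p ⊕ A₁ ⊕ A₂)
  toggle-⊛-true {p} A₁·p A₂·p i rewrite toggle-⊛ p i | A₁·p | A₂·p =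
    cong₂ (λ a b → ((N G ⊛ p) i xor a) xor b) (∧-identityʳ (A₁ i)) (∧-identityʳ (A₂ i))

  toggle-⊛-false : ∀ {p} → A₁ · p ≡ false → A₂ · p ≡ false → (N G* ⊛ p) ≐ (N G ⊛ p)
  toggle-⊛-false {p} A₁·p A₂·p i rewrite toggle-⊛ p i | A₁·p | A₂·p
                                       | ∧-zeroʳ (A₁ i) | ∧-zeroʳ (A₂ i) =
    trans (xor-identityʳ _) (xor-identityʳ _)

  ‾∪≐𝟏⊕⊕ : (‾ (A₁ ∪ A₂)) ≐ (𝟏 ⊕ A₁ ⊕ A₂)
  ‾∪≐𝟏⊕⊕ i = not-∨-disjoint (A₁ i) (A₂ i) (d i)

  module Witnessed {q₁ q₂ : Vec₂ n} (hq₁ : Solves (N G) q₁ A₁) (hq₂ : Solves (N G) q₂ A₂)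
                   (q₁·𝟏 : q₁ · 𝟏 ≡ true) (q₂·𝟏 : q₂ · 𝟏 ≡ true) (q₂·‾A₁ : q₂ · (‾ A₁) ≡ false)
                   where

    q₂·A₁ : q₂ · A₁ ≡ true
    q₂·A₁ = begin
      q₂ · A₁                  ≡⟨ not-involutive (q₂ · A₁) ⟨
      not (not (q₂ · A₁))      ≡⟨ cong (λ b → not (b xor q₂ · A₁)) q₂·𝟏 ⟨
      not (q₂ · 𝟏 xor q₂ · A₁) ≡⟨ cong not (·-distribˡ-⊕ q₂ 𝟏 A₁) ⟨
      not (q₂ · (‾ A₁))        ≡⟨ cong not q₂·‾A₁ ⟩
      true                     ∎

    q₁·A₁ : q₁ · A₁ ≡ true
    q₁·A₁ = trans (·-congˡ q₁ (λ i → sym (hq₁ i))) (trans (·-N⊛-self G q₁) q₁·𝟏)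

    q₂·A₂ : q₂ · A₂ ≡ true
    q₂·A₂ = trans (·-congˡ q₂ (λ i → sym (hq₂ i))) (trans (·-N⊛-self G q₂) q₂·𝟏)

    q₁·A₂ : q₁ · A₂ ≡ true
    q₁·A₂ = begin
      q₁ · A₂ ≡⟨ solution-duality (N-symmetric G) hq₁ hq₂ ⟨
      A₁ · q₂ ≡⟨ ·-comm A₁ q₂ ⟩
      q₂ · A₁ ≡⟨ q₂·A₁ ⟩
      true    ∎

    q₂-solves-A₁ : Solves (N G*) q₂ A₁
    q₂-solves-A₁ i = begin
      (N G* ⊛ q₂) i                     ≡⟨ toggle-⊛-true (trans (·-comm A₁ q₂) q₂·A₁)
                                                         (trans (·-comm A₂ q₂) q₂·A₂) i ⟩
      ((N G ⊛ q₂) i xor A₁ i) xor A₂ i  ≡⟨ cong (λ a → (a xor A₁ i) xor A₂ i) (hq₂ i) ⟩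
      (A₂ i xor A₁ i) xor A₂ i          ≡⟨ xor-cancel-outer (A₁ i) (A₂ i) ⟩
      A₁ i                              ∎

    q₁-solves-A₂ : Solves (N G*) q₁ A₂
    q₁-solves-A₂ i = begin
      (N G* ⊛ q₁) i                     ≡⟨ toggle-⊛-true (trans (·-comm A₁ q₁) q₁·A₁)
                                                         (trans (·-comm A₂ q₁) q₁·A₂) i ⟩
      ((N G ⊛ q₁) i xor A₁ i) xor A₂ i  ≡⟨ cong (λ a → (a xor A₁ i) xor A₂ i) (hq₁ i) ⟩
      (A₁ i xor A₁ i) xor A₂ i          ≡⟨ cong (_xor A₂ i) (xor-same (A₁ i)) ⟩
      A₂ i                              ∎

    all-ones⇔ : ∀ p → Solves (N G*) p 𝟏 ⇔ Solves (N G) p (‾ (A₁ ∪ A₂))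
    all-ones⇔ p = mk⇔ to from
      where
      to : Solves (N G*) p 𝟏 → Solves (N G) p (‾ (A₁ ∪ A₂))
      to h i = trans (xor-xor-move (A₁ i) (A₂ i) (trans (sym (toggle-⊛-true A₁·p A₂·p i)) (h i)))
                     (sym (‾∪≐𝟏⊕⊕ i))
        where
        A₁·p : A₁ · p ≡ true
        A₁·p = trans (solution-duality (N-symmetric G*) q₂-solves-A₁ h) q₂·𝟏
        A₂·p : A₂ · p ≡ true
        A₂·p = trans (solution-duality (N-symmetric G*) q₁-solves-A₂ h) q₁·𝟏

      from : Solves (N G) p (‾ (A₁ ∪ A₂)) → Solves (N G*) p 𝟏
      from h i = trans (toggle-⊛-true A₁·p A₂·p i)
                       (sym (xor-xor-move (A₁ i) (A₂ i) (sym (trans (h i) (‾∪≐𝟏⊕⊕ i)))))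
        where
        ·‾∪ : ∀ {q} → q · 𝟏 ≡ true → q · A₁ ≡ true → q · A₂ ≡ true → q · (‾ (A₁ ∪ A₂)) ≡ true
        ·‾∪ {q} q·𝟏 q·A₁ q·A₂ = begin
          q · (‾ (A₁ ∪ A₂))               ≡⟨ ·-congˡ q ‾∪≐𝟏⊕⊕ ⟩
          q · (𝟏 ⊕ A₁ ⊕ A₂)               ≡⟨ ·-distribˡ-⊕ q (𝟏 ⊕ A₁) A₂ ⟩
          q · (𝟏 ⊕ A₁) xor q · A₂         ≡⟨ cong (_xor q · A₂) (·-distribˡ-⊕ q 𝟏 A₁) ⟩
          (q · 𝟏 xor q · A₁) xor q · A₂   ≡⟨ cong₂ _xor_ (cong₂ _xor_ q·𝟏 q·A₁) q·A₂ ⟩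
          true                            ∎
        A₁·p : A₁ · p ≡ true
        A₁·p = trans (solution-duality (N-symmetric G) hq₁ h) (·‾∪ q₁·𝟏 q₁·A₁ q₁·A₂)
        A₂·p : A₂ · p ≡ true
        A₂·p = trans (solution-duality (N-symmetric G) hq₂ h) (·‾∪ q₂·𝟏 q₂·A₁ q₂·A₂)

    all-ones-solvable : Solvable (N G) (‾ A₁) → Solvable (N G*) 𝟏
    all-ones-solvable (r , hr) = r ⊕ q₂ , Equivalence.from (all-ones⇔ (r ⊕ q₂)) r⊕q₂-solves
      where
      r⊕q₂-solves : Solves (N G) (r ⊕ q₂) (‾ (A₁ ∪ A₂))
      r⊕q₂-solves i = trans (⊛-distrib-⊕ (N G) r q₂ i)
                            (trans (cong₂ _xor_ (hr i) (hq₂ i)) (sym (‾∪≐𝟏⊕⊕ i)))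

    same-kernel : SameKernel (N G*) (N G)
    same-kernel x = mk⇔
      (λ h i → trans (sym (toggle-⊛-false (A·x G* q₂-solves-A₁ h) (A·x G* q₁-solves-A₂ h) i)) (h i))
      (λ h i → trans (toggle-⊛-false (A·x G hq₁ h) (A·x G hq₂ h) i) (h i))
      where
      A·x : ∀ {A} (H : Graph n) {q} → Solves (N H) q A → (N H ⊛ x) ≐ 𝟎 → A · x ≡ false
      A·x H {q} hq h = trans (solution-duality (N-symmetric H) hq h) (·-zeroʳ q)

mainTheorem13 : ∀ {n} (G : Graph n) (A₁ A₂ : Vec₂ n) (d : Disjoint A₁ A₂) →
    AO (N G) A₁ → AO (N G) A₂ → (‾ A₁) -NO[ N G ] A₂ →
    (∀ p → Solves (N (toggle G A₁ A₂ d)) p 𝟏 ⇔ Solves (N G) p (‾ (A₁ ∪ A₂)))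
    × AO (N (toggle G A₁ A₂ d)) A₁
    × AO (N (toggle G A₁ A₂ d)) A₂
    × (∀ k → HasNullity (toggle G A₁ A₂ d) k ⇔ HasNullity G k)
mainTheorem13 G A₁ A₂ d A₁-AO@((q₁ , hq₁) , _) A₂-AO@((q₂ , hq₂) , _) A₂-NO@(_ , ‾A₁-solvable , _) =
  all-ones⇔ ,
  ·≡true⇒AO (N-symmetric G*) q₂-solves-A₁ 𝟏-solvable q₂·𝟏 ,
  ·≡true⇒AO (N-symmetric G*) q₁-solves-A₂ 𝟏-solvable q₁·𝟏 ,
  SameKernel⇒HasNullity⇔ {H = G*} {H′ = G} same-kernel
  where
  open Toggled G A₁ A₂ d
  q₁·𝟏 : q₁ · 𝟏 ≡ true
  q₁·𝟏 = AO⇒·≡true (N-symmetric G) A₁-AO hq₁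
  q₂·𝟏 : q₂ · 𝟏 ≡ true
  q₂·𝟏 = AO⇒·≡true (N-symmetric G) A₂-AO hq₂
  open Witnessed hq₁ hq₂ q₁·𝟏 q₂·𝟏 (NO⇒·≡false (N-symmetric G) A₂-NO hq₂)
  𝟏-solvable : Solvable (N G*) 𝟏
  𝟏-solvable = all-ones-solvable ‾A₁-solvable
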